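{- For every unimodal formula $\phi$, the frame $(W_\phi^{k_\phi},R_\phi^{k_\phi})$ is dense, i.e. it validates $\mathbf{KDe}$.
   Context: Unimodal formulas are built from atoms, $\bot$, $\neg$, $\vee$ and $\square$. Fix a formula $\phi$; let $\Sigma_\phi$ be its set of subformulas, $n_\phi=|\Sigma_\phi|$, and $(\psi_1,\ldots,\psi_{n_\phi})$ an enumeration of $\Sigma_\phi$ such that if $\psi_i=\neg\psi_j$ or $\psi_i=\square\psi_j$ then $i>j$, and if $\psi_i=\psi_j\vee\psi_k$ then $i>j,k$. A $\phi$-tip is a tuple $(a_1,\ldots,a_{n_\phi})\in\{0,1\}^{n_\phi}$ such that $a_i=0$ if $\psi_i=\bot$, $a_i=1-a_j$ if $\psi_i=\neg\psi_j$, $a_i=\max\{a_j,a_k\}$ if $\psi_i=\psi_j\vee\psi_k$. $W_\phi^0$ is the set of all $\phi$-tips and $R_\phi^0$ relates $a$ to $b$ iff for all $i,j$, if $\psi_i=\square\psi_j$ and $a_i=1$ then $b_j=1$. For a structure $(W,R)$ with $W\subseteq W_\phi^0$, $\sigma_\phi(W,R)=(W',R')$ where $W'$ is the set of $a\in W$ such that for all $i,j$ with $\psi_i=\square\psi_j$ and $a_i=0$ there is $b\in W$ with $aRb$ and $b_j=0$; and for $a,b\in W'$, $aR'b$ iff $aRb$ and there is $c\in W$ with $aRc$ and $cRb$. $k_\phi$ is the least $k\in\mathbb{N}$ with $\sigma_\phi^{k+1}(W_\phi^0,R_\phi^0)=\sigma_\phi^k(W_\phi^0,R_\phi^0)$,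 and $(W_\phi^{k_\phi},R_\phi^{k_\phi})=\sigma_\phi^{k_\phi}(W_\phi^0,R_\phi^0)$. A frame $(W,R)$ is dense if whenever $sRt$ there is $u$ with $sRu$ and $uRt$. -}

module Defs where

open import Data.Nat using (ℕ)
import Data.Nat.Properties as ℕP
open import Data.Bool using (Bool; true; false; not; _∨_)
open import Data.Fin using (Fin)
open import Data.Vec using (Vec; lookup)
open import Data.List using (List; []; _∷_; _++_; [_]; length; deduplicate)
import Data.List as L
open import Data.Product using (Σ; _×_; _,_; ∃)
open import Function.Bundles using (_⇔_)
open import Relation.Nullary using (Dec; yes; no; ¬_)
open import Relation.Binary.PropositionalEquality using (_≡_; refl; cong; cong₂)

data Form : Set where
  atom : ℕ → Form
  ⊥f   : Form
  ¬f   : Form → Form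
  _∨f_ : Form → Form → Form
  □f   : Form → Form

infixr 5 _∨f_

_≟f_ : (x y : Form) → Dec (x ≡ y)
atom m ≟f atom n with m ℕP.≟ n
... | yes refl = yes refl
... | no ne = no λ { refl → ne refl }
atom _ ≟f ⊥f = no λ ()
atom _ ≟f ¬f _ = no λ ()
atom _ ≟f (_ ∨f _) = no λ ()
atom _ ≟f □f _ = no λ ()
⊥f ≟f atom _ = no λ ()
⊥f ≟f ⊥f = yes refl
⊥f ≟f ¬f _ = no λ ()
⊥f ≟f (_ ∨f _) = no λ ()
⊥f ≟f □f _ = no λ ()
¬f _ ≟f atom _ = no λ ()
¬f _ ≟f ⊥f = no λ ()
¬f x ≟f ¬f y with x ≟f y
... | yes refl = yes refl
... | no ne = no λ { refl → ne refl }
¬f _ ≟f (_ ∨f _) = no λ ()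
¬f _ ≟f □f _ = no λ ()
(_ ∨f _) ≟f atom _ = no λ ()
(_ ∨f _) ≟f ⊥f = no λ ()
(_ ∨f _) ≟f ¬f _ = no λ ()
(x ∨f x') ≟f (y ∨f y') with x ≟f y | x' ≟f y'
... | yes refl | yes refl = yes refl
... | no ne | _ = no λ { refl → ne refl }
... | yes _ | no ne = no λ { refl → ne refl }
(_ ∨f _) ≟f □f _ = no λ ()
□f _ ≟f atom _ = no λ ()
□f _ ≟f ⊥f = no λ ()
□f _ ≟f ¬f _ = no λ ()
□f _ ≟f (_ ∨f _) = no λ ()
□f x ≟f □f y with x ≟f y
... | yes refl = yes refl
... | no ne = no λ { refl → ne refl }

postorder : Form → List Form
postorder (atom p) = [ atom p ]
postorder ⊥f = [ ⊥f ]
postorder (¬f ψ) = postorder ψ ++ [ ¬f ψ ]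
postorder (ψ ∨f χ) = postorder ψ ++ postorder χ ++ [ ψ ∨f χ ]
postorder (□f ψ) = postorder ψ ++ [ □f ψ ]

-- Σ_φ with a fixed admissible enumeration (ψ_1,…,ψ_n): first occurrences
-- in post-order, so immediate subformulas always get smaller indices.
Sub : Form → List Form
Sub φ = deduplicate _≟f_ (postorder φ)

nSub : Form → ℕ
nSub φ = length (Sub φ)

ψ : (φ : Form) → Fin (nSub φ) → Form
ψ φ i = L.lookup (Sub φ) i

-- tuples in {0,1}^{n_φ}  (false = 0, true = 1)
Tuple : Form → Set
Tuple φ = Vec Bool (nSub φ)

IsTip : (φ : Form) → Tuple φ → Set
IsTip φ a = ∀ i →
    (ψ φ i ≡ ⊥f → lookup a i ≡ false)
  × (∀ j → ψ φ i ≡ ¬f (ψ φ j) → lookup a i ≡ not (lookup a j))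
  × (∀ j k → ψ φ i ≡ (ψ φ j ∨f ψ φ k) → lookup a i ≡ (lookup a j ∨ lookup a k))

record Struct (φ : Form) : Set₁ where
  constructor ⟨_,_⟩
  field
    W : Tuple φ → Set
    R : Tuple φ → Tuple φ → Set
open Struct public

W0 : (φ : Form) → Tuple φ → Set
W0 φ = IsTip φ

R0 : (φ : Form) → Tuple φ → Tuple φ → Set
R0 φ a b = W0 φ a × W0 φ b ×
  (∀ i j → ψ φ i ≡ □f (ψ φ j) → lookup a i ≡ true → lookup b j ≡ true)

S0 : (φ : Form) → Struct φ
S0 φ = ⟨ W0 φ , R0 φ ⟩

σ : (φ : Form) → Struct φ → Struct φ
σ φ S = ⟨ W' , R' ⟩
  where
  W' : Tuple φ → Set
  W' a = W S a × (∀ i j → ψ φ i ≡ □f (ψ φ j) → lookup a i ≡ false →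
           ∃ λ b → W S b × R S a b × lookup b j ≡ false)
  R' : Tuple φ → Tuple φ → Set
  R' a b = W' a × W' b × R S a b × (∃ λ c → W S c × R S a c × R S c b)

σ^ : (φ : Form) → ℕ → Struct φ
σ^ φ ℕ.zero = S0 φ
σ^ φ (ℕ.suc k) = σ φ (σ^ φ k)

_≅_ : ∀ {φ} → Struct φ → Struct φ → Set
S ≅ T = (∀ a → W S a ⇔ W T a) × (∀ a b → R S a b ⇔ R T a b)

IsKφ : (φ : Form) → ℕ → Set
IsKφ φ k = (σ^ φ (ℕ.suc k) ≅ σ^ φ k)
         × (∀ m → σ^ φ (ℕ.suc m) ≅ σ^ φ m → k Data.Nat.≤ m)
  where import Data.Nat

Dense : ∀ {φ} → Struct φ → Set
Dense S = ∀ s t → W S s → W S t → R S s t →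
  ∃ λ u → W S u × R S s u × R S u t

-- Every σ_φ-edge a R' b comes with an interpolant c, a R c R b, in the previous
-- structure; at the fixed point the relation is unchanged by σ_φ, so every edge
-- of (W^k, R^k) is itself such an R'-edge and therefore has an interpolant.
module Submission where

open import Defs
open import Data.Nat using (ℕ)
open import Data.Product using (∃; _×_; _,_)
open import Function.Bundles using (Equivalence)

σ-interpolates : ∀ {φ} (S : Struct φ) {a b} → R (σ φ S) a b →
  ∃ λ c → W S c × R S a c × R S c b
σ-interpolates S (_ , _ , _ , interpolant) = interpolant

σ-fixed⇒dense : ∀ {φ} (S : Struct φ) → σ φ S ≅ S → Dense S
σ-fixed⇒dense S (_ , sameR) s t _ _ sRt =
  σ-interpolates S (Equivalence.from (sameR s t) sRt)

lemma8 : (φ : Form) (k : ℕ) → IsKφ φ k → Dense (σ^ φ k)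
lemma8 φ k (fixed , _) = σ-fixed⇒dense (σ^ φ k) fixed
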